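{- Let $n>5$ and $\sigma\in K_n$. Suppose there is exactly one $\pi\prec\sigma$ with $\pi\in\mathbb{H}$, and that for every $\pi'\in\mathcal{K}$ with $\pi'\prec\sigma$ and $\pi\not\preceq\pi'$, either $\pi'$ avoids $[3142]$ or $\pi'$ avoids $[2413]$. Then $\mu(\sigma)=0$.
   Context: $K_n$ is the set of permutations $\sigma\in S_n$ (one-line notation $[\sigma_1,\dots,\sigma_n]$) with $|\sigma_i-\sigma_{i-1}|\neq1$ for all $2\le i\le n$, and $\mathcal{K}=\bigcup_{n\ge1}K_n$, partially ordered by containment: $\pi\preceq\sigma$ if some subsequence of $\sigma$ is order-isomorphic to $\pi$; $\pi\prec\sigma$ means $\pi\preceq\sigma$, $\pi\ne\sigma$; $\pi'$ avoids $\rho$ if $\rho\not\preceq\pi'$. $\mathbb{H}=\{[24153],[35142],[42513],[31524]\}$, the set of elements of $K_5$ containing both $[2413]$ and $[3142]$. The Möbius function on $\mathcal{K}$ is $\mu(\tau,\sigma)=0$ if $\tau\not\preceq\sigma$, $\mu(\sigma,\sigma)=1$, and otherwise $\mu(\tau,\sigma)=-\sum_{\pi\in\mathcal{K},\,\tau\preceq\pi\prec\sigma}\mu(\tau,\pi)$. We write $\mu(\pi)=\mu([1],\pi)$. -}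

module Defs where

open import Data.Bool using (Bool; true; false; _∧_; T; if_then_else_)
open import Data.Nat using (ℕ; zero; suc; _<ᵇ_; _≡ᵇ_; _≤_; _<_)
import Data.Nat as ℕ
open import Data.Integer using (ℤ; +_; -_; _+_)
open import Data.List using (List; []; _∷_; map; upTo; length; filter; concatMap; foldr)
open import Data.List.Relation.Unary.Any using (Any; any?)
open import Data.List.Relation.Binary.Permutation.Propositional using (_↭_)
open import Data.List.Properties using (≡-dec)
open import Data.Product using (Σ; _×_; ∃-syntax)
open import Relation.Binary.PropositionalEquality using (_≡_; _≢_)
open import Relation.Nullary using (¬_; Dec; yes; no)
open import Relation.Nullary.Decidable using (⌊_⌋; _×-dec_; ¬?)
open import Data.Empty using (⊥)
open import Data.Unit using (⊤)
import Data.Sum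
import Data.List

-- Permutations are lists in one-line notation with values 1..n.
Perm : Set
Perm = List ℕ

oneTo : ℕ → List ℕ
oneTo n = map suc (upTo n)

IsPermOf : ℕ → Perm → Set
IsPermOf n σ = σ ↭ oneTo n

NoAdj : Perm → Set
NoAdj [] = ⊤
NoAdj (a ∷ []) = ⊤
NoAdj (a ∷ b ∷ r) = (a ≢ suc b × b ≢ suc a) × NoAdj (b ∷ r)

noAdj? : (σ : Perm) → Dec (NoAdj σ)
noAdj? [] = yes _
noAdj? (a ∷ []) = yes _
noAdj? (a ∷ b ∷ r) = ((¬? (a ℕ.≟ suc b)) ×-dec (¬? (b ℕ.≟ suc a))) ×-dec noAdj? (b ∷ r)

InK : ℕ → Perm → Set
InK n σ = IsPermOf n σ × NoAdj σ

In𝒦 : Perm → Set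
In𝒦 σ = Σ ℕ λ n → (1 ≤ n) × InK n σ

subseqs : {A : Set} → List A → List (List A)
subseqs [] = [] ∷ []
subseqs (x ∷ xs) = let r = subseqs xs in map (x ∷_) r Data.List.++ r

-- order-isomorphism: same length, and for every pair of positions i < j,
-- a_i < a_j iff b_i < b_j, and a_j < a_i iff b_j < b_i
_⇔ᵇ_ : Bool → Bool → Bool
true ⇔ᵇ true = true
false ⇔ᵇ false = true
_ ⇔ᵇ _ = false

headRel : ℕ → ℕ → List ℕ → List ℕ → Bool
headRel a b [] [] = true
headRel a b (a' ∷ as) (b' ∷ bs) =
  ((a <ᵇ a') ⇔ᵇ (b <ᵇ b')) ∧ ((a' <ᵇ a) ⇔ᵇ (b' <ᵇ b)) ∧ headRel a b as bs
headRel a b _ _ = false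

ordIso : List ℕ → List ℕ → Bool
ordIso [] [] = true
ordIso (a ∷ as) (b ∷ bs) = headRel a b as bs ∧ ordIso as bs
ordIso _ _ = false

_≼_ : Perm → Perm → Set
π ≼ σ = Any (λ s → T (ordIso π s)) (subseqs σ)

_≼?_ : (π σ : Perm) → Dec (π ≼ σ)
π ≼? σ = any? (λ s → Data.Bool.T? (ordIso π s)) (subseqs σ)

_≺_ : Perm → Perm → Set
π ≺ σ = π ≼ σ × π ≢ σ

_≡?_ : (π σ : Perm) → Dec (π ≡ σ)
_≡?_ = ≡-dec ℕ._≟_

insertions : ℕ → List ℕ → List (List ℕ)
insertions x [] = (x ∷ []) ∷ []
insertions x (y ∷ ys) = (x ∷ y ∷ ys) ∷ map (y ∷_) (insertions x ys)

perms : ℕ → List Perm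
perms zero = [] ∷ []
perms (suc n) = concatMap (insertions (suc n)) (perms n)

Klist : ℕ → List Perm
Klist k = filter noAdj? (perms k)

-- all π ∈ 𝒦 with π ≺ σ (such π have length between 1 and |σ|)
below : Perm → List Perm
below σ = filter (λ π → (π ≼? σ) ×-dec ¬? (π ≡? σ))
                 (concatMap Klist (oneTo (length σ)))

sumℤ : List ℤ → ℤ
sumℤ = foldr _+_ (+ 0)

-- Möbius function with fuel (fuel |σ|+1 suffices since chains strictly shorten)
μ-fuel : ℕ → Perm → Perm → ℤ
μ-fuel zero τ σ = + 0
μ-fuel (suc f) τ σ with τ ≼? σ
... | no _ = + 0
... | yes _ with τ ≡? σ
...   | yes _ = + 1
...   | no _ = - sumℤ (map (μ-fuel f τ) (filter (λ π → τ ≼? π) (below σ)))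

μ₂ : Perm → Perm → ℤ
μ₂ τ σ = μ-fuel (suc (length σ)) τ σ

μ : Perm → ℤ
μ σ = μ₂ (1 ∷ []) σ

InH : Perm → Set
InH π = (π ≡ 2 ∷ 4 ∷ 1 ∷ 5 ∷ 3 ∷ [])
      Data.Sum.⊎ ((π ≡ 3 ∷ 5 ∷ 1 ∷ 4 ∷ 2 ∷ [])
      Data.Sum.⊎ ((π ≡ 4 ∷ 2 ∷ 5 ∷ 1 ∷ 3 ∷ [])
      Data.Sum.⊎ (π ≡ 3 ∷ 1 ∷ 5 ∷ 2 ∷ 4 ∷ [])))

p2413 : Perm
p2413 = 2 ∷ 4 ∷ 1 ∷ 3 ∷ []

p3142 : Perm
p3142 = 3 ∷ 1 ∷ 4 ∷ 2 ∷ []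

-- Write μ̂ for the function that is 1 at [1] and at π, −1 at 2413 and 3142, and 0 elsewhere.
-- We show μ = μ̂ on the elements of 𝒦 contained in σ, by induction along the defining recursion
-- μ(x) = −Σ_{z ≺ x} μ(z): by the induction hypothesis the sum only records which of those four
-- permutations lie strictly below x. If x contains both 2413 and 3142, it contains π (by hypothesis, or because
-- x = σ); if it contains exactly one of them, it does not contain π. In both cases the count
-- gives exactly μ̂(x). And x cannot avoid both patterns: a permutation avoiding 2413 and 3142 is
-- a direct or skew sum of shorter such permutations, hence has two neighbouring entries with no
-- value in between, that is, with consecutive values, which 𝒦 forbids. Since |σ| > 5, we get
-- μ(σ) = μ̂(σ) = 0.

module Submission where

open import Defs
open import Data.Bool using (true; false; T; if_then_else_)
open import Data.Bool.Properties using (T-∧; T-≡)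
open import Data.Empty using (⊥-elim)
open import Data.Integer using (ℤ; +_; -_; _+_; _-_)
open import Data.Integer.Properties
  using (+-identityˡ; +-identityʳ; +-assoc; +-commutativeSemigroup; neg-distrib-+)
open import Algebra.Properties.CommutativeSemigroup +-commutativeSemigroup using (interchange)
open import Data.List using (List; []; _∷_; [_]; map; _++_; length; filter; upTo; concatMap)
open import Data.List.Properties
  using ( filter-accept; filter-reject; filter-all; map-++; map-cong-local; length-map
        ; length-upTo; upTo-∷ʳ; ++-assoc; ∷-injective)
open import Data.List.Membership.Propositional using (_∈_; find; lose)
open import Data.List.Membership.Propositional.Properties
  using (∈-map⁺; ∈-map⁻; ∈-++⁺ˡ; ∈-++⁺ʳ; ∈-++⁻; ∈-upTo⁺; ∈-upTo⁻; ∈-concatMap⁻; ∈-filter⁻)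
open import Data.List.Relation.Unary.Any using (here; there)
open import Data.List.Relation.Unary.All using ([]; _∷_)
import Data.List.Relation.Unary.All as All
open import Data.List.Relation.Unary.AllPairs using ([]; _∷_)
open import Data.List.Relation.Unary.Unique.Propositional using (Unique)
import Data.List.Relation.Unary.Unique.Propositional.Properties as Unique
open import Data.List.Relation.Binary.Equality.Propositional using (≋⇒≡)
open import Data.List.Relation.Binary.Sublist.Propositional
  using (_⊆_; []; _∷_; _∷ʳ_; ⊆-refl; ⊆-trans; from∈; lookup)
open import Data.List.Relation.Binary.Sublist.Propositional.Properties
  using (length-mono-≤; filter⁺; to-≋; All-resp-⊆; ++⁺; ++⁺ˡ; ++⁺ʳ)
open import Data.List.Relation.Binary.Permutation.Propositional
  using (_↭_; ↭-sym; ↭-refl; ↭-swap; ↭-trans; ↭-prep; ↭⇒↭ₛ)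
open import Data.List.Relation.Binary.Permutation.Propositional.Properties
  using (↭-length; filter-↭; drop-∷; ∷↭∷ʳ; ∈-resp-↭; ↭-singleton-inv)
open import Data.Nat using (ℕ; zero; suc; _<ᵇ_; _≤_; _<_; z≤n; s≤s)
open import Data.Nat.Properties
  using ( _<?_; _≤?_; <-cmp; <-irrefl; <-trans; <-asym; <⇒≤; <⇒≢; <-≤-trans; ≤-<-trans
        ; ≤-refl; ≤-reflexive; ≤-trans; ≤-antisym; ≤-pred; ≤∧≢⇒<; ≮⇒≥; ≰⇒>; n≮n
        ; <ᵇ⇒<; <⇒<ᵇ; suc-injective; module ≤-Reasoning)
open import Data.Product using (∃; ∃-syntax; Σ-syntax; _×_; _,_; proj₁; proj₂)
open import Data.Sum using (_⊎_; inj₁; inj₂)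
import Data.Sum as Sum
open import Function using (_∘_)
open import Function.Bundles using (Equivalence)
open import Relation.Binary.Definitions using (tri<; tri≈; tri>)
open import Relation.Binary.PropositionalEquality
  using (_≡_; _≢_; ≢-sym; refl; sym; trans; cong; cong₂; subst; setoid; module ≡-Reasoning)
import Data.List.Relation.Binary.Permutation.Setoid.Properties (setoid ℕ) as ↭ₛ
open import Relation.Nullary using (¬_; Dec; does; yes; no)
open import Relation.Nullary.Decidable using (True; toWitness; _×-dec_; ¬?)
open import Relation.Unary using (Pred; Decidable)

open Equivalence using (to; from)

-- Pattern containment via sublists

subseqs⁺ : ∀ {xs ys : List ℕ} → xs ⊆ ys → xs ∈ subseqs ys
subseqs⁺ [] = here refl
subseqs⁺ {ys = _ ∷ ys} (y ∷ʳ τ) = ∈-++⁺ʳ (map (y ∷_) (subseqs ys)) (subseqs⁺ τ)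
subseqs⁺ (refl ∷ τ) = ∈-++⁺ˡ (∈-map⁺ (_ ∷_) (subseqs⁺ τ))

subseqs⁻ : ∀ {xs : List ℕ} ys → xs ∈ subseqs ys → xs ⊆ ys
subseqs⁻ [] (here refl) = []
subseqs⁻ (y ∷ ys) xs∈ with ∈-++⁻ (map (y ∷_) (subseqs ys)) xs∈
... | inj₂ xs∈′ = y ∷ʳ subseqs⁻ ys xs∈′
... | inj₁ xs∈′ with _ , xs′∈ , refl ← ∈-map⁻ (y ∷_) xs∈′ = refl ∷ subseqs⁻ ys xs′∈

≼⁺ : ∀ π {s σ} → s ⊆ σ → T (ordIso π s) → π ≼ σ
≼⁺ π τ iso = lose (subseqs⁺ τ) iso

≼⁻ : ∀ π σ → π ≼ σ → ∃[ s ] s ⊆ σ × T (ordIso π s)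
≼⁻ π σ h with s , s∈ , iso ← find h = s , subseqs⁻ σ s∈ , iso

SameSide : ℕ → ℕ → ℕ → ℕ → Set
SameSide x y a b = (x <ᵇ a) ≡ (y <ᵇ b) × (a <ᵇ x) ≡ (b <ᵇ y)

⇔ᵇ⇒≡ : ∀ {p q} → T (p ⇔ᵇ q) → p ≡ q
⇔ᵇ⇒≡ {true} {true} _ = refl
⇔ᵇ⇒≡ {false} {false} _ = refl

≡⇒⇔ᵇ : ∀ {p q} → p ≡ q → T (p ⇔ᵇ q)
≡⇒⇔ᵇ {true} refl = _
≡⇒⇔ᵇ {false} refl = _

headRel-∷⁻ : ∀ x y a b as bs →
  T (headRel x y (a ∷ as) (b ∷ bs)) → SameSide x y a b × T (headRel x y as bs)
headRel-∷⁻ _ _ _ _ _ _ h with t₁ , h′ ← to T-∧ h with t₂ , t₃ ← to T-∧ h′ =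
  (⇔ᵇ⇒≡ t₁ , ⇔ᵇ⇒≡ t₂) , t₃

headRel-∷⁺ : ∀ x y a b as bs →
  SameSide x y a b → T (headRel x y as bs) → T (headRel x y (a ∷ as) (b ∷ bs))
headRel-∷⁺ _ _ _ _ _ _ (e₁ , e₂) h = from T-∧ (≡⇒⇔ᵇ e₁ , from T-∧ (≡⇒⇔ᵇ e₂ , h))

ordIso-∷⁻ : ∀ a b as bs → T (ordIso (a ∷ as) (b ∷ bs)) → T (headRel a b as bs) × T (ordIso as bs)
ordIso-∷⁻ _ _ _ _ = to T-∧

ordIso-∷⁺ : ∀ a b as bs → T (headRel a b as bs) → T (ordIso as bs) → T (ordIso (a ∷ as) (b ∷ bs))
ordIso-∷⁺ _ _ _ _ h i = from T-∧ (h , i)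

headRel-refl : ∀ x as → T (headRel x x as as)
headRel-refl x [] = _
headRel-refl x (a ∷ as) = headRel-∷⁺ x x a a as as (refl , refl) (headRel-refl x as)

headRel-trans : ∀ x y z as bs cs →
  T (headRel x y as bs) → T (headRel y z bs cs) → T (headRel x z as cs)
headRel-trans _ _ _ [] [] [] _ _ = _
headRel-trans x y z (a ∷ as) (b ∷ bs) (c ∷ cs) h₁ h₂
  with (e₁ , e₂) , h₁′ ← headRel-∷⁻ x y a b as bs h₁
     | (e₃ , e₄) , h₂′ ← headRel-∷⁻ y z b c bs cs h₂ =
  headRel-∷⁺ x z a c as cs (trans e₁ e₃ , trans e₂ e₄) (headRel-trans x y z as bs cs h₁′ h₂′)

ordIso-refl : ∀ as → T (ordIso as as)
ordIso-refl [] = _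
ordIso-refl (a ∷ as) = ordIso-∷⁺ a a as as (headRel-refl a as) (ordIso-refl as)

ordIso-trans : ∀ as bs cs → T (ordIso as bs) → T (ordIso bs cs) → T (ordIso as cs)
ordIso-trans [] [] [] _ _ = _
ordIso-trans (a ∷ as) (b ∷ bs) (c ∷ cs) i₁ i₂
  with h₁ , i₁′ ← ordIso-∷⁻ a b as bs i₁ | h₂ , i₂′ ← ordIso-∷⁻ b c bs cs i₂ =
  ordIso-∷⁺ a c as cs (headRel-trans a b c as bs cs h₁ h₂) (ordIso-trans as bs cs i₁′ i₂′)

ordIso⇒length≡ : ∀ as bs → T (ordIso as bs) → length as ≡ length bs
ordIso⇒length≡ [] [] _ = refl
ordIso⇒length≡ (a ∷ as) (b ∷ bs) i = cong suc (ordIso⇒length≡ as bs (proj₂ (ordIso-∷⁻ a b as bs i)))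

-- the entries of bs at the positions where τ keeps an entry of as
select : ∀ {s as : List ℕ} → s ⊆ as → List ℕ → List ℕ
select [] _ = []
select (_ ∷ʳ τ) (_ ∷ bs) = select τ bs
select (_ ∷ τ) (b ∷ bs) = b ∷ select τ bs
select _ [] = []

select-⊆ : ∀ {s as} (τ : s ⊆ as) bs → length as ≡ length bs → select τ bs ⊆ bs
select-⊆ [] [] _ = []
select-⊆ (_ ∷ʳ τ) (b ∷ bs) e = b ∷ʳ select-⊆ τ bs (suc-injective e)
select-⊆ (_ ∷ τ) (b ∷ bs) e = refl ∷ select-⊆ τ bs (suc-injective e)

select-headRel : ∀ x y {s as} (τ : s ⊆ as) bs →
  T (headRel x y as bs) → T (headRel x y s (select τ bs))
select-headRel x y [] [] _ = _
select-headRel x y {as = a ∷ as} (.a ∷ʳ τ) (b ∷ bs) h =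
  select-headRel x y τ bs (proj₂ (headRel-∷⁻ x y a b as bs h))
select-headRel x y {a ∷ s} {a ∷ as} (refl ∷ τ) (b ∷ bs) h
  with same , h′ ← headRel-∷⁻ x y a b as bs h =
  headRel-∷⁺ x y a b s (select τ bs) same (select-headRel x y τ bs h′)

select-ordIso : ∀ {s as} (τ : s ⊆ as) bs → T (ordIso as bs) → T (ordIso s (select τ bs))
select-ordIso [] [] _ = _
select-ordIso {as = a ∷ as} (.a ∷ʳ τ) (b ∷ bs) i = select-ordIso τ bs (proj₂ (ordIso-∷⁻ a b as bs i))
select-ordIso {a ∷ s} {a ∷ as} (refl ∷ τ) (b ∷ bs) i with h , i′ ← ordIso-∷⁻ a b as bs i =
  ordIso-∷⁺ a b s (select τ bs) (select-headRel a b τ bs h) (select-ordIso τ bs i′)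

⊆⇒≼ : ∀ {s σ} → s ⊆ σ → s ≼ σ
⊆⇒≼ {s} τ = ≼⁺ s τ (ordIso-refl s)

≼-refl : ∀ σ → σ ≼ σ
≼-refl σ = ⊆⇒≼ {σ} ⊆-refl

≼-trans : ∀ {π ρ σ} → π ≼ ρ → ρ ≼ σ → π ≼ σ
≼-trans {π} {ρ} {σ} h₁ h₂ with s , s⊆ρ , i₁ ← ≼⁻ π ρ h₁ | t , t⊆σ , i₂ ← ≼⁻ ρ σ h₂ =
  ≼⁺ π (⊆-trans (select-⊆ s⊆ρ t (ordIso⇒length≡ ρ t i₂)) t⊆σ)
     (ordIso-trans π s (select s⊆ρ t) i₁ (select-ordIso s⊆ρ t i₂))

≼⇒length≤ : ∀ {π σ} → π ≼ σ → length π ≤ length σ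
≼⇒length≤ {π} {σ} h with s , s⊆σ , i ← ≼⁻ π σ h =
  subst (_≤ length σ) (sym (ordIso⇒length≡ π s i)) (length-mono-≤ s⊆σ)

-- Order-isomorphic rearrangements

countBelow : ℕ → List ℕ → ℕ
countBelow v l = length (filter (_<? v) l)

countBelow-↭ : ∀ v {l m} → l ↭ m → countBelow v l ≡ countBelow v m
countBelow-↭ v p = ↭-length (filter-↭ (_<? v) p)

countBelow-mono : ∀ {a b} l → a ≤ b → countBelow a l ≤ countBelow b l
countBelow-mono l a≤b =
  length-mono-≤ (filter⁺ (_<? _) (_<? _) (λ { refl u<a → <-≤-trans u<a a≤b }) (⊆-refl {x = l}))

countBelow-headRel : ∀ a b as bs → T (headRel a b as bs) → countBelow a as ≡ countBelow b bs
countBelow-headRel a b [] [] _ = refl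
countBelow-headRel a b (u ∷ as) (w ∷ bs) h with (_ , e) , h′ ← headRel-∷⁻ a b u w as bs h
  with u <ᵇ a | w <ᵇ b | e | countBelow-headRel a b as bs h′
... | true | true | refl | ih = cong suc ih
... | false | false | refl | ih = ih

equal-countBelow⇒≮ : ∀ {a b as bs} → countBelow a as ≡ countBelow b bs → a ∷ as ↭ b ∷ bs → ¬ a < b
equal-countBelow⇒≮ {a} {b} {as} {bs} rank≡ p a<b = n≮n (countBelow a as) (begin-strict
  countBelow a as        <⟨ s≤s (countBelow-mono as (<⇒≤ a<b)) ⟩
  suc (countBelow b as)  ≡⟨ cong length (filter-accept (_<? b) a<b) ⟨
  countBelow b (a ∷ as)  ≡⟨ countBelow-↭ b p ⟩
  countBelow b (b ∷ bs)  ≡⟨ cong length (filter-reject (_<? b) (n≮n b)) ⟩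
  countBelow b bs        ≡⟨ rank≡ ⟨
  countBelow a as        ∎)
  where open ≤-Reasoning

-- In a rearrangement the head is determined by its rank (the number of smaller entries),
-- and order-isomorphic lists have heads of equal rank.
ordIso∧↭⇒≡ : ∀ as bs → T (ordIso as bs) → as ↭ bs → as ≡ bs
ordIso∧↭⇒≡ [] [] _ _ = refl
ordIso∧↭⇒≡ (a ∷ as) (b ∷ bs) i p with h , i′ ← ordIso-∷⁻ a b as bs i
  with rank≡ ← countBelow-headRel a b as bs h | <-cmp a b
... | tri< a<b _ _ = ⊥-elim (equal-countBelow⇒≮ rank≡ p a<b)
... | tri> _ _ b<a = ⊥-elim (equal-countBelow⇒≮ (sym rank≡) (↭-sym p) b<a)
... | tri≈ _ refl _ = cong (a ∷_) (ordIso∧↭⇒≡ as bs i′ (drop-∷ p))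

≼∧↭⇒≡ : ∀ {π σ} → π ≼ σ → length π ≡ length σ → π ↭ σ → π ≡ σ
≼∧↭⇒≡ {π} {σ} h len p with s , s⊆σ , i ← ≼⁻ π σ h
  with refl ← ≋⇒≡ (to-≋ (trans (sym (ordIso⇒length≡ π s i)) len) s⊆σ) = ordIso∧↭⇒≡ π σ i p

-- Enumerating 𝒦

length-oneTo : ∀ n → length (oneTo n) ≡ n
length-oneTo n = trans (length-map suc (upTo n)) (length-upTo n)

oneTo-suc : ∀ n → oneTo (suc n) ≡ oneTo n ++ [ suc n ]
oneTo-suc n = trans (cong (map suc) (sym (upTo-∷ʳ n))) (map-++ suc (upTo n) [ n ])

∈-oneTo⁻ : ∀ {n y} → y ∈ oneTo n → 1 ≤ y × y ≤ n
∈-oneTo⁻ y∈ with _ , i∈ , refl ← ∈-map⁻ suc y∈ = s≤s z≤n , ∈-upTo⁻ i∈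

∈-oneTo⁺ : ∀ {n y} → 1 ≤ y → y ≤ n → y ∈ oneTo n
∈-oneTo⁺ {y = suc i} _ y≤n = ∈-map⁺ suc (∈-upTo⁺ y≤n)

↭-oneTo⇒length : ∀ {x k} → x ↭ oneTo k → length x ≡ k
↭-oneTo⇒length {k = k} p = trans (↭-length p) (length-oneTo k)

insertions-↭ : ∀ x l {z} → z ∈ insertions x l → z ↭ x ∷ l
insertions-↭ x [] (here refl) = ↭-refl
insertions-↭ x (y ∷ ys) (here refl) = ↭-refl
insertions-↭ x (y ∷ ys) (there z∈) with w , w∈ , refl ← ∈-map⁻ (y ∷_) z∈ =
  ↭-trans (↭-prep y (insertions-↭ x ys w∈)) (↭-swap y x ↭-refl)

perms-↭ : ∀ k {z} → z ∈ perms k → z ↭ oneTo k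
perms-↭ zero (here refl) = ↭-refl
perms-↭ (suc n) z∈ with p , p∈ , z∈′ ← find (∈-concatMap⁻ (insertions (suc n)) {xs = perms n} z∈) =
  ↭-trans (insertions-↭ (suc n) p z∈′) (↭-trans (↭-prep (suc n) (perms-↭ n p∈))
    (subst (suc n ∷ oneTo n ↭_) (sym (oneTo-suc n)) (∷↭∷ʳ (suc n) (oneTo n))))

Klist⁻ : ∀ k {z} → z ∈ Klist k → InK k z
Klist⁻ k z∈ with z∈′ , noAdj ← ∈-filter⁻ noAdj? z∈ = perms-↭ k z∈′ , noAdj

below⁻ : ∀ σ {π} → π ∈ below σ → In𝒦 π × π ≺ σ
below⁻ σ π∈ with π∈′ , π≺σ ← ∈-filter⁻ (λ π → (π ≼? σ) ×-dec ¬? (π ≡? σ)) π∈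
  with k , k∈ , π∈K ← find (∈-concatMap⁻ Klist {xs = oneTo (length σ)} π∈′) =
  (k , proj₁ (∈-oneTo⁻ k∈) , Klist⁻ k π∈K) , π≺σ

≺⇒length< : ∀ {π σ} → In𝒦 π → In𝒦 σ → π ≺ σ → length π < length σ
≺⇒length< {π} {σ} (k , _ , πk , _) (m , _ , σm , _) (π≼σ , π≢σ) =
  ≤∧≢⇒< (≼⇒length≤ {π} {σ} π≼σ) λ len →
    let m≡k = trans (sym (↭-oneTo⇒length σm)) (trans (sym len) (↭-oneTo⇒length πk))
    in π≢σ (≼∧↭⇒≡ π≼σ len (↭-trans πk (subst (λ j → oneTo j ↭ σ) m≡k (↭-sym σm))))

-- Separable permutations

Separable : List ℕ → Set
Separable x = ¬ p2413 ≼ x × ¬ p3142 ≼ x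

Separable-⊆ : ∀ {s x} → s ⊆ x → Separable x → Separable s
Separable-⊆ {s} {x} τ (∌2413 , ∌3142) =
  (λ h → ∌2413 (≼-trans {p2413} {s} {x} h (⊆⇒≼ τ))) ,
  (λ h → ∌3142 (≼-trans {p3142} {s} {x} h (⊆⇒≼ τ)))

Unique-⊆ : ∀ {s x : List ℕ} → s ⊆ x → Unique x → Unique s
Unique-⊆ [] [] = []
Unique-⊆ (_ ∷ʳ τ) (_ ∷ u) = Unique-⊆ τ u
Unique-⊆ (refl ∷ τ) (h ∷ u) = All-resp-⊆ τ h ∷ Unique-⊆ τ u

Unique-++⇒≢ : ∀ (A : List ℕ) {B a b} → Unique (A ++ B) → a ∈ A → b ∈ B → a ≢ b
Unique-++⇒≢ (_ ∷ A) (h ∷ _) (here refl) b∈ = All.lookup h (∈-++⁺ʳ A b∈)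
Unique-++⇒≢ (_ ∷ A) (_ ∷ u) (there a∈) b∈ = Unique-++⇒≢ A u a∈ b∈

_<ˡ_ : List ℕ → List ℕ → Set
A <ˡ B = ∀ {a b} → a ∈ A → b ∈ B → a < b

<ˡ-or-inversion : ∀ A B → A <ˡ B ⊎ ∃[ a ] ∃[ b ] a ∈ A × b ∈ B × b ≤ a
<ˡ-or-inversion [] B = inj₁ λ ()
<ˡ-or-inversion (x ∷ A) B with below-all B | <ˡ-or-inversion A B
  where
  below-all : ∀ C → (∀ {c} → c ∈ C → x < c) ⊎ ∃[ c ] c ∈ C × c ≤ x
  below-all [] = inj₁ λ ()
  below-all (c ∷ C) with x <? c | below-all C
  ... | no x≮c | _ = inj₂ (c , here refl , ≮⇒≥ x≮c)
  ... | yes _ | inj₂ (c′ , c′∈ , c′≤x) = inj₂ (c′ , there c′∈ , c′≤x)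
  ... | yes x<c | inj₁ x<C = inj₁ λ { (here refl) → x<c ; (there c∈) → x<C c∈ }
... | inj₂ (b , b∈ , b≤x) | _ = inj₂ (x , b , here refl , b∈ , b≤x)
... | inj₁ _ | inj₂ (a , b , a∈ , b∈ , b≤a) = inj₂ (a , b , there a∈ , b∈ , b≤a)
... | inj₁ x<B | inj₁ A<B = inj₁ λ { (here refl) → x<B ; (there a∈) → A<B a∈ }

<ᵇ-true : ∀ {a b} → a < b → (a <ᵇ b) ≡ true
<ᵇ-true = to T-≡ ∘ <⇒<ᵇ

<ᵇ-false : ∀ {a b} → b < a → (a <ᵇ b) ≡ false
<ᵇ-false {a} {b} b<a with a <ᵇ b in eq
... | false = refl
... | true = ⊥-elim (<-asym b<a (<ᵇ⇒< a b (subst T (sym eq) _)))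

2413-witness : ∀ {g l b M} → g < l → l < b → b < M → T (ordIso p2413 (l ∷ M ∷ g ∷ b ∷ []))
2413-witness g<l l<b b<M
  rewrite <ᵇ-true g<l | <ᵇ-false g<l | <ᵇ-true l<b | <ᵇ-false l<b | <ᵇ-true b<M | <ᵇ-false b<M
        | <ᵇ-true (<-trans g<l l<b) | <ᵇ-false (<-trans g<l l<b)
        | <ᵇ-true (<-trans l<b b<M) | <ᵇ-false (<-trans l<b b<M)
        | <ᵇ-true (<-trans g<l (<-trans l<b b<M)) | <ᵇ-false (<-trans g<l (<-trans l<b b<M)) = _

3142-witness : ∀ {d r a M} → d < r → r < a → a < M → T (ordIso p3142 (a ∷ d ∷ M ∷ r ∷ []))
3142-witness d<r r<a a<M
  rewrite <ᵇ-true d<r | <ᵇ-false d<r | <ᵇ-true r<a | <ᵇ-false r<a | <ᵇ-true a<M | <ᵇ-false a<M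
        | <ᵇ-true (<-trans d<r r<a) | <ᵇ-false (<-trans d<r r<a)
        | <ᵇ-true (<-trans r<a a<M) | <ᵇ-false (<-trans r<a a<M)
        | <ᵇ-true (<-trans d<r (<-trans r<a a<M)) | <ᵇ-false (<-trans d<r (<-trans r<a a<M)) = _

-- a direct sum (left <ˡ right) or a skew sum (right <ˡ left)
record Decomposition (x : List ℕ) : Set where
  constructor decomposition
  field
    left right : List ℕ
    split : x ≡ left ++ right
    left-nonempty : ∃ (_∈ left)
    right-nonempty : ∃ (_∈ right)
    ordered : left <ˡ right ⊎ right <ˡ left

++-≡-++⁻ : ∀ (L R α β : List ℕ) → L ++ R ≡ α ++ β →
  (∃[ γ ] α ≡ L ++ γ × R ≡ γ ++ β) ⊎ (∃[ δ ] L ≡ α ++ δ × β ≡ δ ++ R)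
++-≡-++⁻ [] R α β eq = inj₁ (α , refl , eq)
++-≡-++⁻ (l ∷ L) R [] β eq = inj₂ (l ∷ L , refl , sym eq)
++-≡-++⁻ (l ∷ L) R (a ∷ α) β eq with refl , eq′ ← ∷-injective eq with ++-≡-++⁻ L R α β eq′
... | inj₁ (γ , refl , R≡) = inj₁ (γ , refl , R≡)
... | inj₂ (δ , refl , β≡) = inj₂ (δ , refl , β≡)

-- Reinserting the maximum M of L ++ M ∷ R into a decomposition α ++ β of L ++ R: only two of
-- the four cases can fail, and then they create a 2413 or a 3142.
insertMax-direct-left : ∀ L γ β {M b} → b ∈ β → (L ++ γ) <ˡ β →
  (∀ {u} → u ∈ L ++ γ ++ β → u < M) → Separable (L ++ M ∷ γ ++ β) → Unique (L ++ M ∷ γ ++ β) →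
  Decomposition (L ++ M ∷ γ ++ β)
insertMax-direct-left [] γ β {M} {b} b∈ _ M-max _ _ =
  decomposition [ M ] (γ ++ β) refl (M , here refl) (b , ∈-++⁺ʳ γ b∈)
    (inj₂ λ { u∈ (here refl) → M-max u∈ })
insertMax-direct-left L@(l₀ ∷ _) γ β {M} {b} b∈ α<β M-max sep uniq with <ˡ-or-inversion L γ
... | inj₁ L<γ = decomposition L (M ∷ γ ++ β) refl (l₀ , here refl) (M , here refl) (inj₁ L<rest)
  where
  L<rest : L <ˡ (M ∷ γ ++ β)
  L<rest l∈ (here refl) = M-max (∈-++⁺ˡ l∈)
  L<rest l∈ (there c∈) with ∈-++⁻ γ c∈
  ... | inj₁ g∈ = L<γ l∈ g∈
  ... | inj₂ b′∈ = α<β (∈-++⁺ˡ l∈) b′∈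
... | inj₂ (l , g , l∈ , g∈ , g≤l) = ⊥-elim (proj₁ sep (≼⁺ p2413 occurrence (2413-witness g<l l<b b<M)))
  where
  occurrence : l ∷ M ∷ g ∷ b ∷ [] ⊆ L ++ M ∷ γ ++ β
  occurrence = ++⁺ (from∈ l∈) (refl ∷ ++⁺ (from∈ g∈) (from∈ b∈))
  g<l = ≤∧≢⇒< g≤l λ g≡l → Unique-++⇒≢ L uniq l∈ (there (∈-++⁺ˡ g∈)) (sym g≡l)
  l<b = α<β (∈-++⁺ˡ l∈) b∈
  b<M = M-max (∈-++⁺ʳ L (∈-++⁺ʳ γ b∈))

insertMax-direct-right : ∀ α δ R {M a} → a ∈ α → α <ˡ (δ ++ R) →
  (∀ {u} → u ∈ (α ++ δ) ++ R → u < M) → Decomposition ((α ++ δ) ++ M ∷ R)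
insertMax-direct-right α δ R {M} {a} a∈ α<β M-max =
  decomposition α (δ ++ M ∷ R) (++-assoc α δ (M ∷ R)) (a , a∈) (M , ∈-++⁺ʳ δ (here refl))
    (inj₁ α<rest)
  where
  α<rest : α <ˡ (δ ++ M ∷ R)
  α<rest a′∈ c∈ with ∈-++⁻ δ c∈
  ... | inj₁ d∈ = α<β a′∈ (∈-++⁺ˡ d∈)
  ... | inj₂ (here refl) = M-max (∈-++⁺ˡ (∈-++⁺ˡ a′∈))
  ... | inj₂ (there r∈) = α<β a′∈ (∈-++⁺ʳ δ r∈)

insertMax-skew-left : ∀ L γ β {M b} → b ∈ β → β <ˡ (L ++ γ) →
  (∀ {u} → u ∈ L ++ γ ++ β → u < M) → Decomposition (L ++ M ∷ γ ++ β)
insertMax-skew-left L γ β {M} {b} b∈ β<α M-max =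
  decomposition (L ++ M ∷ γ) β (sym (++-assoc L (M ∷ γ) β)) (M , ∈-++⁺ʳ L (here refl)) (b , b∈)
    (inj₂ β<rest)
  where
  β<rest : β <ˡ (L ++ M ∷ γ)
  β<rest b′∈ c∈ with ∈-++⁻ L c∈
  ... | inj₁ l∈ = β<α b′∈ (∈-++⁺ˡ l∈)
  ... | inj₂ (here refl) = M-max (∈-++⁺ʳ L (∈-++⁺ʳ γ b′∈))
  ... | inj₂ (there g∈) = β<α b′∈ (∈-++⁺ʳ L g∈)

insertMax-skew-right : ∀ α δ R {M a} → a ∈ α → (δ ++ R) <ˡ α →
  (∀ {u} → u ∈ (α ++ δ) ++ R → u < M) → Separable ((α ++ δ) ++ M ∷ R) → Unique ((α ++ δ) ++ M ∷ R) →
  Decomposition ((α ++ δ) ++ M ∷ R)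
insertMax-skew-right α δ [] {M} {a} a∈ _ M-max _ _ =
  decomposition (α ++ δ) [ M ] refl (a , ∈-++⁺ˡ a∈) (M , here refl)
    (inj₁ λ { u∈ (here refl) → M-max (∈-++⁺ˡ u∈) })
insertMax-skew-right α δ R@(r₀ ∷ _) {M} {a} a∈ β<α M-max sep uniq with <ˡ-or-inversion R δ
... | inj₁ R<δ = decomposition (α ++ δ ++ [ M ]) R regroup (a , ∈-++⁺ˡ a∈) (r₀ , here refl) (inj₂ R<rest)
  where
  regroup : (α ++ δ) ++ M ∷ R ≡ (α ++ δ ++ [ M ]) ++ R
  regroup = trans (++-assoc α δ (M ∷ R))
    (sym (trans (++-assoc α (δ ++ [ M ]) R) (cong (α ++_) (++-assoc δ [ M ] R))))
  R<rest : R <ˡ (α ++ δ ++ [ M ])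
  R<rest r∈ c∈ with ∈-++⁻ α c∈
  ... | inj₁ a′∈ = β<α (∈-++⁺ʳ δ r∈) a′∈
  ... | inj₂ c∈′ with ∈-++⁻ δ c∈′
  ...   | inj₁ d∈ = R<δ r∈ d∈
  ...   | inj₂ (here refl) = M-max (∈-++⁺ʳ (α ++ δ) r∈)
... | inj₂ (r , d , r∈ , d∈ , d≤r) = ⊥-elim (proj₂ sep (≼⁺ p3142 occurrence (3142-witness d<r r<a a<M)))
  where
  occurrence : a ∷ d ∷ M ∷ r ∷ [] ⊆ (α ++ δ) ++ M ∷ R
  occurrence = subst (_ ⊆_) (sym (++-assoc α δ (M ∷ R)))
    (++⁺ (from∈ a∈) (++⁺ (from∈ d∈) (refl ∷ from∈ r∈)))
  d<r = ≤∧≢⇒< d≤r (Unique-++⇒≢ (α ++ δ) uniq (∈-++⁺ʳ α d∈) (there r∈))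
  r<a = β<α (∈-++⁺ʳ δ r∈) a∈
  a<M = M-max (∈-++⁺ˡ (∈-++⁺ˡ a∈))

maximum-split : ∀ a x →
  Σ[ L ∈ List ℕ ] Σ[ M ∈ ℕ ] Σ[ R ∈ List ℕ ] a ∷ x ≡ L ++ M ∷ R × (∀ {u} → u ∈ a ∷ x → u ≤ M)
maximum-split a [] = [] , a , [] , refl , λ { (here refl) → ≤-refl }
maximum-split a (b ∷ x) with L , M , R , eq , M-max ← maximum-split b x | a ≤? M
... | yes a≤M = a ∷ L , M , R , cong (a ∷_) eq , λ { (here refl) → a≤M ; (there u∈) → M-max u∈ }
... | no a≰M = [] , a , b ∷ x , refl ,
  λ { (here refl) → ≤-refl ; (there u∈) → ≤-trans (M-max u∈) (<⇒≤ (≰⇒> a≰M)) }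

delete-⊆ : ∀ (L : List ℕ) M R → L ++ R ⊆ L ++ M ∷ R
delete-⊆ L M R = ++⁺ ⊆-refl (M ∷ʳ ⊆-refl)

length-insert : ∀ (L : List ℕ) M R → length (L ++ M ∷ R) ≡ suc (length (L ++ R))
length-insert [] M R = refl
length-insert (_ ∷ L) M R = cong suc (length-insert L M R)

unique-maximum : ∀ L M R → Unique (L ++ M ∷ R) → (∀ {u} → u ∈ L ++ M ∷ R → u ≤ M) →
  ∀ {u} → u ∈ L ++ R → u < M
unique-maximum L M R uniq M-max {u} u∈ = ≤∧≢⇒< (M-max (lookup (delete-⊆ L M R) u∈)) u≢M
  where
  u≢M : u ≢ M
  u≢M with ∈-++⁻ L u∈
  ... | inj₁ u∈L = Unique-++⇒≢ L uniq u∈L (here refl)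
  ... | inj₂ u∈R with M≢R ∷ _ ← Unique-⊆ (++⁺ˡ L ⊆-refl) uniq = λ u≡M → All.lookup M≢R u∈R (sym u≡M)

insertMax : ∀ L M R → (∀ {u} → u ∈ L ++ R → u < M) → Separable (L ++ M ∷ R) → Unique (L ++ M ∷ R) →
  Decomposition (L ++ R) → Decomposition (L ++ M ∷ R)
insertMax L M R M-max sep uniq (decomposition α β eq (a , a∈) (b , b∈) ordered)
  with ++-≡-++⁻ L R α β eq | ordered
... | inj₁ (γ , refl , refl) | inj₁ α<β = insertMax-direct-left L γ β b∈ α<β M-max sep uniq
... | inj₁ (γ , refl , refl) | inj₂ β<α = insertMax-skew-left L γ β b∈ β<α M-max
... | inj₂ (δ , refl , refl) | inj₁ α<β = insertMax-direct-right α δ R a∈ α<β M-max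
... | inj₂ (δ , refl , refl) | inj₂ β<α = insertMax-skew-right α δ R a∈ β<α M-max sep uniq

separable⇒decomposition : ∀ n x → length x ≡ suc (suc n) → Unique x → Separable x → Decomposition x
separable⇒decomposition zero (a ∷ b ∷ []) _ ((a≢b ∷ []) ∷ _) _ with <-cmp a b
... | tri< a<b _ _ = decomposition [ a ] [ b ] refl (a , here refl) (b , here refl)
  (inj₁ λ { (here refl) (here refl) → a<b })
... | tri≈ _ a≡b _ = ⊥-elim (a≢b a≡b)
... | tri> _ _ b<a = decomposition [ a ] [ b ] refl (a , here refl) (b , here refl)
  (inj₂ λ { (here refl) (here refl) → b<a })
separable⇒decomposition (suc n) (a ∷ x) len uniq sep with L , M , R , eq , M-max ← maximum-split a x =
  subst Decomposition (sym eq)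
    (insertMax L M R (unique-maximum L M R uniq′ (M-max ∘ subst (_ ∈_) (sym eq))) sep′ uniq′
      (separable⇒decomposition n (L ++ R) length′ (Unique-⊆ (delete-⊆ L M R) uniq′)
        (Separable-⊆ (delete-⊆ L M R) sep′)))
  where
  uniq′ : Unique (L ++ M ∷ R)
  uniq′ = subst Unique eq uniq
  sep′ : Separable (L ++ M ∷ R)
  sep′ = subst Separable eq sep
  length′ : length (L ++ R) ≡ suc (suc n)
  length′ = suc-injective (trans (sym (length-insert L M R)) (trans (cong length (sym eq)) len))

Between : ℕ → ℕ → ℕ → Set
Between a b u = (a < u × u < b) ⊎ (b < u × u < a)

outside⇒¬Between : ∀ {a b u} → (a < u × b < u) ⊎ (u < a × u < b) → ¬ Between a b u
outside⇒¬Between (inj₁ (_ , b<u)) (inj₁ (_ , u<b)) = <-asym b<u u<b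
outside⇒¬Between (inj₁ (a<u , _)) (inj₂ (_ , u<a)) = <-asym a<u u<a
outside⇒¬Between (inj₂ (u<a , _)) (inj₁ (a<u , _)) = <-asym u<a a<u
outside⇒¬Between (inj₂ (_ , u<b)) (inj₂ (b<u , _)) = <-asym u<b b<u

RankAdjacent : List ℕ → Set
RankAdjacent x = Σ[ L ∈ List ℕ ] Σ[ a ∈ ℕ ] Σ[ b ∈ ℕ ] Σ[ R ∈ List ℕ ]
  x ≡ L ++ a ∷ b ∷ R × a ≢ b × (∀ {u} → u ∈ x → ¬ Between a b u)

rankAdjacent-pair : ∀ {a b} → a ≢ b → RankAdjacent (a ∷ b ∷ [])
rankAdjacent-pair {a} {b} a≢b = [] , a , b , [] , refl , a≢b , λ
  { (here refl) (inj₁ (a<a , _)) → <-irrefl refl a<a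
  ; (here refl) (inj₂ (_ , a<a)) → <-irrefl refl a<a
  ; (there (here refl)) (inj₁ (_ , b<b)) → <-irrefl refl b<b
  ; (there (here refl)) (inj₂ (b<b , _)) → <-irrefl refl b<b }

module _ {α β : List ℕ} (ordered : α <ˡ β ⊎ β <ˡ α) where

  rankAdjacent-++ˡ : RankAdjacent α → RankAdjacent (α ++ β)
  rankAdjacent-++ˡ (L , a , b , R , refl , a≢b , gap) =
    L , a , b , R ++ β , ++-assoc L (a ∷ b ∷ R) β , a≢b , gap′
    where
    a∈ = ∈-++⁺ʳ L (here refl)
    b∈ = ∈-++⁺ʳ L (there (here refl))
    gap′ : ∀ {u} → u ∈ α ++ β → ¬ Between a b u
    gap′ u∈ with ∈-++⁻ α u∈
    ... | inj₁ u∈α = gap u∈α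
    ... | inj₂ u∈β = outside⇒¬Between
      (Sum.map (λ α<β → α<β a∈ u∈β , α<β b∈ u∈β) (λ β<α → β<α u∈β a∈ , β<α u∈β b∈) ordered)

  rankAdjacent-++ʳ : RankAdjacent β → RankAdjacent (α ++ β)
  rankAdjacent-++ʳ (L , a , b , R , refl , a≢b , gap) =
    α ++ L , a , b , R , sym (++-assoc α L (a ∷ b ∷ R)) , a≢b , gap′
    where
    a∈ = ∈-++⁺ʳ L (here refl)
    b∈ = ∈-++⁺ʳ L (there (here refl))
    gap′ : ∀ {u} → u ∈ α ++ β → ¬ Between a b u
    gap′ u∈ with ∈-++⁻ α u∈
    ... | inj₂ u∈β = gap u∈β
    ... | inj₁ u∈α = outside⇒¬Between (Sum.swap
      (Sum.map (λ α<β → α<β u∈α a∈ , α<β u∈α b∈) (λ β<α → β<α a∈ u∈α , β<α b∈ u∈α) ordered))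

length-<-++ : ∀ (α : List ℕ) {β b} → b ∈ β → length α < length (α ++ β)
length-<-++ [] (here _) = s≤s z≤n
length-<-++ [] (there _) = s≤s z≤n
length-<-++ (_ ∷ α) b∈ = s≤s (length-<-++ α b∈)

separable⇒rankAdjacent : ∀ n x → length x ≤ n → 2 ≤ length x → Unique x → Separable x → RankAdjacent x

decomposition⇒rankAdjacent : ∀ n α β → length (α ++ β) ≤ suc n → ∃ (_∈ α) → ∃ (_∈ β) →
  α <ˡ β ⊎ β <ˡ α → Unique (α ++ β) → Separable (α ++ β) → RankAdjacent (α ++ β)
decomposition⇒rankAdjacent n α@(_ ∷ _ ∷ _) β len _ (_ , b∈) ordered uniq sep =
  rankAdjacent-++ˡ ordered (separable⇒rankAdjacent n α (≤-pred (<-≤-trans (length-<-++ α b∈) len))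
    (s≤s (s≤s z≤n)) (Unique-⊆ α⊆ uniq) (Separable-⊆ α⊆ sep))
  where α⊆ = ++⁺ʳ β ⊆-refl
decomposition⇒rankAdjacent n α@(_ ∷ []) β@(_ ∷ _ ∷ _) len _ _ ordered uniq sep =
  rankAdjacent-++ʳ ordered (separable⇒rankAdjacent n β (≤-pred len)
    (s≤s (s≤s z≤n)) (Unique-⊆ β⊆ uniq) (Separable-⊆ β⊆ sep))
  where β⊆ = ++⁺ˡ α ⊆-refl
decomposition⇒rankAdjacent n (a ∷ []) (b ∷ []) _ _ _ (inj₁ α<β) _ _ =
  rankAdjacent-pair (<⇒≢ (α<β (here refl) (here refl)))
decomposition⇒rankAdjacent n (a ∷ []) (b ∷ []) _ _ _ (inj₂ β<α) _ _ =
  rankAdjacent-pair (≢-sym (<⇒≢ (β<α (here refl) (here refl))))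
decomposition⇒rankAdjacent n [] β _ (_ , ()) _ _ _ _
decomposition⇒rankAdjacent n (_ ∷ []) [] _ _ (_ , ()) _ _ _

separable⇒rankAdjacent (suc n) (_ ∷ []) _ (s≤s ()) _ _
separable⇒rankAdjacent (suc n) x@(_ ∷ _ ∷ x′) len _ uniq sep
  with decomposition α β split α-ne β-ne ordered ← separable⇒decomposition (length x′) x refl uniq sep =
  subst RankAdjacent (sym split)
    (decomposition⇒rankAdjacent n α β (subst (λ y → length y ≤ suc n) split len) α-ne β-ne ordered
      (subst Unique split uniq) (subst Separable split sep))

NoAdj-++ : ∀ L a b R → NoAdj (L ++ a ∷ b ∷ R) → a ≢ suc b × b ≢ suc a
NoAdj-++ [] a b R (a≁b , _) = a≁b
NoAdj-++ (_ ∷ []) a b R (_ , noAdj) = NoAdj-++ [] a b R noAdj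
NoAdj-++ (_ ∷ y ∷ L) a b R (_ , noAdj) = NoAdj-++ (y ∷ L) a b R noAdj

successor-between : ∀ {k x lo hi} → x ↭ oneTo k → hi ∈ x → lo < hi → hi ≢ suc lo →
  suc lo ∈ x × Between lo hi (suc lo)
successor-between p hi∈ lo<hi hi≢1+lo =
  ∈-resp-↭ (↭-sym p) (∈-oneTo⁺ (s≤s z≤n) (≤-trans lo<hi (proj₂ (∈-oneTo⁻ (∈-resp-↭ p hi∈))))) ,
  inj₁ (≤-refl , ≤∧≢⇒< lo<hi (≢-sym hi≢1+lo))

rankAdjacent⇒¬NoAdj : ∀ {k x} → x ↭ oneTo k → RankAdjacent x → ¬ NoAdj x
rankAdjacent⇒¬NoAdj p (L , a , b , R , refl , a≢b , gap) noAdj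
  with a≢1+b , b≢1+a ← NoAdj-++ L a b R noAdj | <-cmp a b
... | tri< a<b _ _ =
  let u∈ , between = successor-between p (∈-++⁺ʳ L (there (here refl))) a<b b≢1+a in gap u∈ between
... | tri≈ _ a≡b _ = a≢b a≡b
... | tri> _ _ b<a =
  let u∈ , between = successor-between p (∈-++⁺ʳ L (here refl)) b<a a≢1+b in gap u∈ (Sum.swap between)

InK⇒¬Separable : ∀ {k x} → InK k x → 2 ≤ k → ¬ Separable x
InK⇒¬Separable {k} {x} (p , noAdj) 2≤k sep = rankAdjacent⇒¬NoAdj p rankAdjacent noAdj
  where
  uniq : Unique x
  uniq = ↭ₛ.Unique-resp-↭ (↭⇒↭ₛ (↭-sym p)) (Unique.map⁺ suc-injective (Unique.upTo⁺ k))
  rankAdjacent : RankAdjacent x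
  rankAdjacent = separable⇒rankAdjacent (length x) x ≤-refl
    (subst (2 ≤_) (sym (↭-oneTo⇒length p)) 2≤k) uniq sep

-- Sums and occurrence counts

module _ {A : Set} (g : A → ℤ) where

  sumℤ-map-++ : ∀ xs ys → sumℤ (map g (xs ++ ys)) ≡ sumℤ (map g xs) + sumℤ (map g ys)
  sumℤ-map-++ [] ys = sym (+-identityˡ _)
  sumℤ-map-++ (x ∷ xs) ys = trans (cong (λ r → g x + r) (sumℤ-map-++ xs ys)) (sym (+-assoc (g x) _ _))

  sumℤ-map-zero : ∀ xs → (∀ {x} → x ∈ xs → g x ≡ + 0) → sumℤ (map g xs) ≡ + 0
  sumℤ-map-zero [] _ = refl
  sumℤ-map-zero (x ∷ xs) g≡0 = cong₂ _+_ (g≡0 (here refl)) (sumℤ-map-zero xs (g≡0 ∘ there))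

  sumℤ-map-filter : ∀ {ℓ} {P : Pred A ℓ} (P? : Decidable P) → (∀ x → ¬ P x → g x ≡ + 0) →
    ∀ xs → sumℤ (map g (filter P? xs)) ≡ sumℤ (map g xs)
  sumℤ-map-filter P? g≡0 [] = refl
  sumℤ-map-filter P? g≡0 (x ∷ xs) with P? x
  ... | yes _ = cong (λ r → g x + r) (sumℤ-map-filter P? g≡0 xs)
  ... | no ¬Px = trans (sumℤ-map-filter P? g≡0 xs)
    (sym (trans (cong (λ r → r + sumℤ (map g xs)) (g≡0 x ¬Px)) (+-identityˡ _)))

  sumℤ-map-neg : ∀ xs → sumℤ (map (λ x → - g x) xs) ≡ - sumℤ (map g xs)
  sumℤ-map-neg [] = refl
  sumℤ-map-neg (x ∷ xs) = trans (cong (λ r → - g x + r) (sumℤ-map-neg xs)) (sym (neg-distrib-+ (g x) _))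

sumℤ-map-+ : ∀ {A : Set} (f g : A → ℤ) xs →
  sumℤ (map (λ x → f x + g x) xs) ≡ sumℤ (map f xs) + sumℤ (map g xs)
sumℤ-map-+ f g [] = refl
sumℤ-map-+ f g (x ∷ xs) =
  trans (cong (λ r → f x + g x + r) (sumℤ-map-+ f g xs)) (interchange (f x) (g x) _ _)

sumℤ-map-- : ∀ {A : Set} (f g : A → ℤ) xs →
  sumℤ (map (λ x → f x - g x) xs) ≡ sumℤ (map f xs) - sumℤ (map g xs)
sumℤ-map-- f g xs =
  trans (sumℤ-map-+ f (λ x → - g x) xs) (cong (λ r → sumℤ (map f xs) + r) (sumℤ-map-neg g xs))

sumℤ-map-concatMap : ∀ {A B : Set} (g : B → ℤ) (f : A → List B) xs →
  sumℤ (map g (concatMap f xs)) ≡ sumℤ (map (λ x → sumℤ (map g (f x))) xs)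
sumℤ-map-concatMap g f [] = refl
sumℤ-map-concatMap g f (x ∷ xs) =
  trans (sumℤ-map-++ g (f x) (concatMap f xs)) (cong (λ r → sumℤ (map g (f x)) + r) (sumℤ-map-concatMap g f xs))

sumℤ-map-oneTo-point : ∀ (g : ℕ → ℤ) {p} → (∀ j → j ≢ p → g j ≡ + 0) → 1 ≤ p →
  ∀ m → p ≤ m → sumℤ (map g (oneTo m)) ≡ g p
sumℤ-map-oneTo-point g {suc p} g≡0 1≤p zero ()
sumℤ-map-oneTo-point g {p} g≡0 1≤p (suc m) p≤1+m = begin
  sumℤ (map g (oneTo (suc m)))                ≡⟨ cong (sumℤ ∘ map g) (oneTo-suc m) ⟩
  sumℤ (map g (oneTo m ++ [ suc m ]))         ≡⟨ sumℤ-map-++ g (oneTo m) [ suc m ] ⟩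
  sumℤ (map g (oneTo m)) + (g (suc m) + + 0)  ≡⟨ by-cases (p ≤? m) ⟩
  g p                                         ∎
  where
  open ≡-Reasoning
  by-cases : Dec (p ≤ m) → sumℤ (map g (oneTo m)) + (g (suc m) + + 0) ≡ g p
  by-cases (yes p≤m) = trans (cong₂ (λ a b → a + (b + + 0)) (sumℤ-map-oneTo-point g g≡0 1≤p m p≤m)
    (g≡0 (suc m) (λ e → <-irrefl (sym e) (s≤s p≤m)))) (+-identityʳ (g p))
  by-cases (no p≰m) with refl ← ≤-antisym p≤1+m (≰⇒> p≰m) =
    trans (cong (_+ (g p + + 0))
             (sumℤ-map-zero g (oneTo m) λ j∈ → g≡0 _ λ { refl → p≰m (proj₂ (∈-oneTo⁻ j∈)) }))
      (trans (+-identityˡ _) (+-identityʳ (g p)))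

δ : Perm → Perm → ℤ
δ s z = if does (z ≡? s) then + 1 else + 0

occ : Perm → List Perm → ℤ
occ s L = sumℤ (map (δ s) L)

δ-refl : ∀ s → δ s s ≡ + 1
δ-refl s with s ≡? s
... | yes _ = refl
... | no s≢s = ⊥-elim (s≢s refl)

δ-≢ : ∀ s z → z ≢ s → δ s z ≡ + 0
δ-≢ s z z≢s with z ≡? s
... | yes z≡s = ⊥-elim (z≢s z≡s)
... | no _ = refl

occ-Klist-≢ : ∀ s j → j ≢ length s → occ s (Klist j) ≡ + 0
occ-Klist-≢ s j j≢ = sumℤ-map-zero (δ s) (Klist j) λ {z} z∈ →
  δ-≢ s z λ { refl → j≢ (sym (↭-oneTo⇒length (proj₁ (Klist⁻ j z∈)))) }

occ-below-≺ : ∀ {s} σ → 1 ≤ length s → s ≺ σ → occ s (below σ) ≡ occ s (Klist (length s))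
occ-below-≺ {s} σ 1≤∣s∣ s≺σ = begin
  occ s (below σ)
    ≡⟨ sumℤ-map-filter (δ s) _ (λ z ¬≺ → δ-≢ s z λ { refl → ¬≺ s≺σ })
         (concatMap Klist (oneTo (length σ))) ⟩
  sumℤ (map (δ s) (concatMap Klist (oneTo (length σ))))
    ≡⟨ sumℤ-map-concatMap (δ s) Klist (oneTo (length σ)) ⟩
  sumℤ (map (λ j → occ s (Klist j)) (oneTo (length σ)))
    ≡⟨ sumℤ-map-oneTo-point (λ j → occ s (Klist j)) (occ-Klist-≢ s) 1≤∣s∣
         (length σ) (≼⇒length≤ {s} {σ} (proj₁ s≺σ)) ⟩
  occ s (Klist (length s))
    ∎
  where open ≡-Reasoning

occ-below-≺₁ : ∀ {s} σ → occ s (Klist (length s)) ≡ + 1 → 1 ≤ length s → s ≺ σ → occ s (below σ) ≡ + 1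
occ-below-≺₁ σ occ≡1 1≤∣s∣ s≺σ = trans (occ-below-≺ σ 1≤∣s∣ s≺σ) occ≡1

occ-below-⊀ : ∀ {s} σ → ¬ s ≺ σ → occ s (below σ) ≡ + 0
occ-below-⊀ {s} σ s⊀σ = sumℤ-map-zero (δ s) (below σ) λ {z} z∈ →
  δ-≢ s z λ { refl → s⊀σ (proj₂ (below⁻ σ z∈)) }

-- The Möbius function below σ

p1 : Perm
p1 = 1 ∷ []

p1≼ : ∀ {x} → In𝒦 x → p1 ≼ x
p1≼ {[]} (_ , 1≤k , p , _) = ⊥-elim (<-irrefl (↭-oneTo⇒length p) 1≤k)
p1≼ {a ∷ x} _ = ≼⁺ p1 {σ = a ∷ x} (from∈ (here refl)) _

p1≺ : ∀ {x} → In𝒦 x → x ≢ p1 → p1 ≺ x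
p1≺ x∈𝒦 x≢p1 = p1≼ x∈𝒦 , ≢-sym x≢p1

K-size≥2 : ∀ {k x} → InK k x → 1 ≤ k → x ≢ p1 → 2 ≤ k
K-size≥2 {suc zero} (p , _) _ x≢p1 = ⊥-elim (x≢p1 (↭-singleton-inv p))
K-size≥2 {suc (suc k)} _ _ _ = s≤s (s≤s z≤n)

shorter⇒≢ : ∀ {x y : Perm} → length x < length y → x ≢ y
shorter⇒≢ ∣x∣<∣y∣ refl = <-irrefl refl ∣x∣<∣y∣

μ-fuel-diag : ∀ f τ → μ-fuel (suc f) τ τ ≡ + 1
μ-fuel-diag f τ with τ ≼? τ
... | no τ⋠τ = ⊥-elim (τ⋠τ (≼-refl τ))
... | yes _ with τ ≡? τ
...   | yes _ = refl
...   | no τ≢τ = ⊥-elim (τ≢τ refl)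

μ-fuel-step : ∀ f {τ σ} → τ ≼ σ → τ ≢ σ →
  μ-fuel (suc f) τ σ ≡ - sumℤ (map (μ-fuel f τ) (filter (λ π → τ ≼? π) (below σ)))
μ-fuel-step f {τ} {σ} τ≼σ τ≢σ with τ ≼? σ
... | no τ⋠σ = ⊥-elim (τ⋠σ τ≼σ)
... | yes _ with τ ≡? σ
...   | yes τ≡σ = ⊥-elim (τ≢σ τ≡σ)
...   | no _ = refl

μ̂ : Perm → Perm → ℤ
μ̂ π z = δ p1 z + δ π z - δ p2413 z - δ p3142 z

sumℤ-map-μ̂ : ∀ π L → sumℤ (map (μ̂ π) L) ≡ occ p1 L + occ π L - occ p2413 L - occ p3142 L
sumℤ-map-μ̂ π L = begin
  sumℤ (map (μ̂ π) L)
    ≡⟨ sumℤ-map-- (λ z → δ p1 z + δ π z - δ p2413 z) (δ p3142) L ⟩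
  sumℤ (map (λ z → δ p1 z + δ π z - δ p2413 z) L) - occ p3142 L
    ≡⟨ cong (_- occ p3142 L) (sumℤ-map-- (λ z → δ p1 z + δ π z) (δ p2413) L) ⟩
  sumℤ (map (λ z → δ p1 z + δ π z) L) - occ p2413 L - occ p3142 L
    ≡⟨ cong (λ t → t - occ p2413 L - occ p3142 L) (sumℤ-map-+ (δ p1) (δ π) L) ⟩
  occ p1 L + occ π L - occ p2413 L - occ p3142 L
    ∎
  where open ≡-Reasoning

record ℍ-facts (π : Perm) : Set where
  field
    length≡5 : length π ≡ 5
    2413≼ : p2413 ≼ π
    3142≼ : p3142 ≼ π
    occ-Klist : occ π (Klist (length π)) ≡ + 1

decided-ℍ-facts : ∀ π → {True (p2413 ≼? π)} → {True (p3142 ≼? π)} →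
  length π ≡ 5 → occ π (Klist (length π)) ≡ + 1 → ℍ-facts π
decided-ℍ-facts π {c₁} {c₂} len occ≡1 = record
  { length≡5 = len
  ; 2413≼ = toWitness {a? = p2413 ≼? π} c₁
  ; 3142≼ = toWitness {a? = p3142 ≼? π} c₂
  ; occ-Klist = occ≡1
  }

InH⇒ℍ-facts : ∀ {π} → InH π → ℍ-facts π
InH⇒ℍ-facts (inj₁ refl) = decided-ℍ-facts _ refl refl
InH⇒ℍ-facts (inj₂ (inj₁ refl)) = decided-ℍ-facts _ refl refl
InH⇒ℍ-facts (inj₂ (inj₂ (inj₁ refl))) = decided-ℍ-facts _ refl refl
InH⇒ℍ-facts (inj₂ (inj₂ (inj₂ refl))) = decided-ℍ-facts _ refl refl

module ℍ-values {π : Perm} (π∈ℍ : InH π) where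

  open ℍ-facts (InH⇒ℍ-facts π∈ℍ) public

  MöbiusRecursionAt : Perm → Set
  MöbiusRecursionAt x = - sumℤ (map (μ̂ π) (below x)) ≡ μ̂ π x

  π≢short : ∀ {x} → length x ≤ 4 → π ≢ x
  π≢short ∣x∣≤4 refl = <-irrefl length≡5 (s≤s ∣x∣≤4)

  μ̂-p1 : μ̂ π p1 ≡ + 1
  μ̂-p1 rewrite δ-≢ π p1 (≢-sym (π≢short (s≤s z≤n))) = refl

  μ̂-p2413 : μ̂ π p2413 ≡ - + 1
  μ̂-p2413 rewrite δ-≢ π p2413 (≢-sym (π≢short ≤-refl)) = refl

  μ̂-p3142 : μ̂ π p3142 ≡ - + 1
  μ̂-p3142 rewrite δ-≢ π p3142 (≢-sym (π≢short ≤-refl)) = refl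

  μ̂-π : μ̂ π π ≡ + 1
  μ̂-π rewrite δ-≢ p1 π (π≢short (s≤s z≤n)) | δ-≢ p2413 π (π≢short ≤-refl)
            | δ-≢ p3142 π (π≢short ≤-refl) | δ-refl π = refl

  μ̂-other : ∀ {x} → x ≢ p1 → x ≢ π → x ≢ p2413 → x ≢ p3142 → μ̂ π x ≡ + 0
  μ̂-other {x} x≢p1 x≢π x≢2413 x≢3142
    rewrite δ-≢ p1 x x≢p1 | δ-≢ π x x≢π | δ-≢ p2413 x x≢2413 | δ-≢ p3142 x x≢3142 = refl

  negated-μ̂-sum : ∀ x {a b c d} → occ p1 (below x) ≡ a → occ π (below x) ≡ b →
    occ p2413 (below x) ≡ c → occ p3142 (below x) ≡ d → - sumℤ (map (μ̂ π) (below x)) ≡ - (a + b - c - d)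
  negated-μ̂-sum x e₁ e₂ e₃ e₄ =
    cong -_ (trans (sumℤ-map-μ̂ π (below x)) (cong₂ _-_ (cong₂ _-_ (cong₂ _+_ e₁ e₂) e₃) e₄))

  occ-π-below : ∀ x → π ≺ x → occ π (below x) ≡ + 1
  occ-π-below x = occ-below-≺₁ x occ-Klist (subst (1 ≤_) (sym length≡5) (s≤s z≤n))

  recursion-both : ∀ {x} → p1 ≺ x → p2413 ≼ x → p3142 ≼ x → π ≼ x → MöbiusRecursionAt x
  recursion-both {x} p1≺x 2413≼x 3142≼x π≼x = by-cases (x ≡? π)
    where
    4<∣x∣ : 4 < length x
    4<∣x∣ = subst (_≤ length x) length≡5 (≼⇒length≤ {π} {x} π≼x)
    occ₁ : occ p1 (below x) ≡ + 1
    occ₁ = occ-below-≺₁ x refl (s≤s z≤n) p1≺x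
    occ₂ : occ p2413 (below x) ≡ + 1
    occ₂ = occ-below-≺₁ x refl (s≤s z≤n) (2413≼x , shorter⇒≢ 4<∣x∣)
    occ₃ : occ p3142 (below x) ≡ + 1
    occ₃ = occ-below-≺₁ x refl (s≤s z≤n) (3142≼x , shorter⇒≢ 4<∣x∣)
    by-cases : Dec (x ≡ π) → MöbiusRecursionAt x
    by-cases (yes x≡π) =
      trans (negated-μ̂-sum x occ₁ (occ-below-⊀ x λ (_ , π≢x) → π≢x (sym x≡π)) occ₂ occ₃)
        (sym (subst (λ y → μ̂ π y ≡ + 1) (sym x≡π) μ̂-π))
    by-cases (no x≢π) =
      trans (negated-μ̂-sum x occ₁ (occ-π-below x (π≼x , ≢-sym x≢π)) occ₂ occ₃)
        (sym (μ̂-other (≢-sym (proj₂ p1≺x)) x≢π (≢-sym (shorter⇒≢ 4<∣x∣)) (≢-sym (shorter⇒≢ 4<∣x∣))))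

  recursion-2413 : ∀ {x} → p1 ≺ x → p2413 ≼ x → ¬ p3142 ≼ x → MöbiusRecursionAt x
  recursion-2413 {x} p1≺x 2413≼x ∌3142 = by-cases (x ≡? p2413)
    where
    occ₁ : occ p1 (below x) ≡ + 1
    occ₁ = occ-below-≺₁ x refl (s≤s z≤n) p1≺x
    occπ : occ π (below x) ≡ + 0
    occπ = occ-below-⊀ x λ (π≼x , _) → ∌3142 (≼-trans {p3142} {π} {x} 3142≼ π≼x)
    occ₃ : occ p3142 (below x) ≡ + 0
    occ₃ = occ-below-⊀ x (∌3142 ∘ proj₁)
    by-cases : Dec (x ≡ p2413) → MöbiusRecursionAt x
    by-cases (yes x≡2413) =
      trans (negated-μ̂-sum x occ₁ occπ (occ-below-⊀ x λ (_ , 2413≢x) → 2413≢x (sym x≡2413)) occ₃)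
        (sym (subst (λ y → μ̂ π y ≡ - + 1) (sym x≡2413) μ̂-p2413))
    by-cases (no x≢2413) =
      trans (negated-μ̂-sum x occ₁ occπ (occ-below-≺₁ x refl (s≤s z≤n) (2413≼x , ≢-sym x≢2413)) occ₃)
        (sym (μ̂-other (≢-sym (proj₂ p1≺x)) (λ x≡π → ∌3142 (subst (p3142 ≼_) (sym x≡π) 3142≼)) x≢2413
          (λ x≡3142 → ∌3142 (subst (p3142 ≼_) (sym x≡3142) (≼-refl p3142)))))

  recursion-3142 : ∀ {x} → p1 ≺ x → ¬ p2413 ≼ x → p3142 ≼ x → MöbiusRecursionAt x
  recursion-3142 {x} p1≺x ∌2413 3142≼x = by-cases (x ≡? p3142)
    where
    occ₁ : occ p1 (below x) ≡ + 1
    occ₁ = occ-below-≺₁ x refl (s≤s z≤n) p1≺x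
    occπ : occ π (below x) ≡ + 0
    occπ = occ-below-⊀ x λ (π≼x , _) → ∌2413 (≼-trans {p2413} {π} {x} 2413≼ π≼x)
    occ₂ : occ p2413 (below x) ≡ + 0
    occ₂ = occ-below-⊀ x (∌2413 ∘ proj₁)
    by-cases : Dec (x ≡ p3142) → MöbiusRecursionAt x
    by-cases (yes x≡3142) =
      trans (negated-μ̂-sum x occ₁ occπ occ₂ (occ-below-⊀ x λ (_ , 3142≢x) → 3142≢x (sym x≡3142)))
        (sym (subst (λ y → μ̂ π y ≡ - + 1) (sym x≡3142) μ̂-p3142))
    by-cases (no x≢3142) =
      trans (negated-μ̂-sum x occ₁ occπ occ₂ (occ-below-≺₁ x refl (s≤s z≤n) (3142≼x , ≢-sym x≢3142)))
        (sym (μ̂-other (≢-sym (proj₂ p1≺x)) (λ x≡π → ∌2413 (subst (p2413 ≼_) (sym x≡π) 2413≼))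
          (λ x≡2413 → ∌2413 (subst (p2413 ≼_) (sym x≡2413) (≼-refl p2413))) x≢3142))

module Downset {σ π : Perm} (π∈ℍ : InH π) (π≼σ : π ≼ σ)
  (hyp : (π' : Perm) → In𝒦 π' → π' ≺ σ → ¬ (π ≼ π') → (¬ (p3142 ≼ π')) ⊎ (¬ (p2413 ≼ π'))) where

  open ℍ-values π∈ℍ public

  π≼-of-both : ∀ {x} → In𝒦 x → x ≼ σ → p2413 ≼ x → p3142 ≼ x → π ≼ x
  π≼-of-both {x} x∈𝒦 x≼σ 2413≼x 3142≼x with x ≡? σ | π ≼? x
  ... | yes refl | _ = π≼σ
  ... | no _ | yes π≼x = π≼x
  ... | no x≢σ | no π⋠x with hyp x x∈𝒦 (x≼σ , x≢σ) π⋠x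
  ...   | inj₁ ∌3142 = ⊥-elim (∌3142 3142≼x)
  ...   | inj₂ ∌2413 = ⊥-elim (∌2413 2413≼x)

  μ̂-recursion : ∀ {x} → In𝒦 x → x ≼ σ → x ≢ p1 → MöbiusRecursionAt x
  μ̂-recursion {x} x∈𝒦@(_ , 1≤k , x∈K) x≼σ x≢p1 with p2413 ≼? x | p3142 ≼? x
  ... | yes 2413≼x | yes 3142≼x =
    recursion-both (p1≺ x∈𝒦 x≢p1) 2413≼x 3142≼x (π≼-of-both x∈𝒦 x≼σ 2413≼x 3142≼x)
  ... | yes 2413≼x | no ∌3142 = recursion-2413 (p1≺ x∈𝒦 x≢p1) 2413≼x ∌3142
  ... | no ∌2413 | yes 3142≼x = recursion-3142 (p1≺ x∈𝒦 x≢p1) ∌2413 3142≼x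
  ... | no ∌2413 | no ∌3142 = ⊥-elim (InK⇒¬Separable x∈K (K-size≥2 x∈K 1≤k x≢p1) (∌2413 , ∌3142))

  μ-fuel≡μ̂ : ∀ f x → In𝒦 x → x ≼ σ → length x < f → μ-fuel f p1 x ≡ μ̂ π x
  μ-fuel≡μ̂ (suc f) x x∈𝒦 x≼σ ∣x∣<f = by-cases (x ≡? p1)
    where
    open ≡-Reasoning
    induction : ∀ {z} → z ∈ below x → μ-fuel f p1 z ≡ μ̂ π z
    induction {z} z∈ with z∈𝒦 , z≺x ← below⁻ x z∈ =
      μ-fuel≡μ̂ f z z∈𝒦 (≼-trans {z} {x} {σ} (proj₁ z≺x) x≼σ)
        (<-≤-trans (≺⇒length< z∈𝒦 x∈𝒦 z≺x) (≤-pred ∣x∣<f))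
    by-cases : Dec (x ≡ p1) → μ-fuel (suc f) p1 x ≡ μ̂ π x
    by-cases (yes x≡p1) =
      subst (λ y → μ-fuel (suc f) p1 y ≡ μ̂ π y) (sym x≡p1) (trans (μ-fuel-diag f p1) (sym μ̂-p1))
    by-cases (no x≢p1) = begin
      μ-fuel (suc f) p1 x
        ≡⟨ μ-fuel-step f (p1≼ x∈𝒦) (≢-sym x≢p1) ⟩
      - sumℤ (map (μ-fuel f p1) (filter (λ z → p1 ≼? z) (below x)))
        ≡⟨ cong (λ L → - sumℤ (map (μ-fuel f p1) L))
             (filter-all (λ z → p1 ≼? z) (All.tabulate (p1≼ ∘ proj₁ ∘ below⁻ x))) ⟩
      - sumℤ (map (μ-fuel f p1) (below x))
        ≡⟨ cong (λ L → - sumℤ L) (map-cong-local (All.tabulate induction)) ⟩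
      - sumℤ (map (μ̂ π) (below x))
        ≡⟨ μ̂-recursion x∈𝒦 x≼σ x≢p1 ⟩
      μ̂ π x
        ∎

mainTheorem14 : (n : ℕ) → 5 < n → (σ : Perm) → InK n σ →
    (π : Perm) → InH π → π ≺ σ →
    ((π₀ : Perm) → InH π₀ → π₀ ≺ σ → π₀ ≡ π) →
    ((π' : Perm) → In𝒦 π' → π' ≺ σ → ¬ (π ≼ π') →
      (¬ (p3142 ≼ π')) ⊎ (¬ (p2413 ≼ π'))) →
    μ σ ≡ + 0
mainTheorem14 n 5<n σ σ∈K π π∈ℍ π≺σ _ hyp = begin
  μ σ    ≡⟨ μ-fuel≡μ̂ (suc (length σ)) σ (n , ≤-trans (s≤s z≤n) 5<n , σ∈K) (≼-refl σ) ≤-refl ⟩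
  μ̂ π σ  ≡⟨ μ̂-other (longer p1 (s≤s z≤n)) (longer π (≤-reflexive length≡5))
                     (longer p2413 4≤5) (longer p3142 4≤5) ⟩
  + 0    ∎
  where
  open ≡-Reasoning
  open Downset π∈ℍ (proj₁ π≺σ) hyp
  4≤5 : 4 ≤ 5
  4≤5 = s≤s (s≤s (s≤s (s≤s z≤n)))
  longer : ∀ y → length y ≤ 5 → σ ≢ y
  longer _ ∣y∣≤5 = ≢-sym (shorter⇒≢ (≤-<-trans ∣y∣≤5 5<∣σ∣))
    where
    5<∣σ∣ : 5 < length σ
    5<∣σ∣ = subst (5 <_) (sym (↭-oneTo⇒length (proj₁ σ∈K))) 5<n
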